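{- The following six mesh patterns $(12,R)$ are pairwise equidistributed, where $R$ ranges over: $\{(0,2),(1,2),(2,2),(0,1),(1,1),(2,1)\}$, $\{(0,2),(1,2),(0,1),(1,1),(0,0),(1,0)\}$, $\{(1,2),(2,2),(1,1),(2,1),(1,0),(2,0)\}$, $\{(0,1),(1,1),(2,1),(0,0),(1,0),(2,0)\}$, $\{(0,2),(2,2),(0,1),(2,1),(0,0),(2,0)\}$, $\{(0,2),(1,2),(2,2),(0,0),(1,0),(2,0)\}$. Moreover, for each such pattern $p$, $s_{0,0}(p)=s_{1,0}(p)=1$, and for $n\ge2$, $s_{n,0}(p)=n!/2$ and $s_{n,1}(p)=n!/2$. Equivalently, $$\sum_{n\ge0}x^n\sum_{\pi\in S_n}q^{p(\pi)}=\frac{(1-q)(1+x)}{2}+\frac{1+q}{2}F(x),\qquad F(x)=\sum_{n\ge0}n!\,x^n.$$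
   Context: For $R\subseteq\{0,1,2\}^2$ and $\pi=\pi_1\cdots\pi_n\in S_n$, an occurrence of the mesh pattern $(12,R)$ in $\pi$ is a pair of positions $i_1<i_2$ with $\pi_{i_1}<\pi_{i_2}$ such that, setting $x_0=0,x_1=i_1,x_2=i_2,x_3=n+1$ and $y_0=0,y_1=\pi_{i_1},y_2=\pi_{i_2},y_3=n+1$, for every $(a,b)\in R$ there is no index $k$ with $x_a<k<x_{a+1}$ and $y_b<\pi_k<y_{b+1}$. $p(\pi)$ is the number of occurrences of $p$ in $\pi$; $s_{n,k}(p)$ the number of $\pi\in S_n$ with $p(\pi)=k$; $p_1,p_2$ are equidistributed if $s_{n,k}(p_1)=s_{n,k}(p_2)$ for all $n,k\ge 0$. Generating functions are formal power series. -}

module Defs where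

open import Data.Nat using (ℕ; zero; suc; _<ᵇ_; _≡ᵇ_; _+_)
open import Data.Bool using (Bool; true; false; _∧_; _∨_; not; if_then_else_)
open import Data.Fin using (Fin; toℕ; zero; suc)
open import Data.Product using (_×_; _,_)
open import Data.List using (List; []; _∷_; map; concatMap; length; upTo)
open import Data.Bool.ListAction using (all; any)
open import Relation.Binary.PropositionalEquality using (_≡_)

-- A permutation π ∈ S_n is represented by its one-line notation π₁ ⋯ πₙ,
-- a list of length n with entries in {1,…,n}, pairwise distinct.

keep : {A : Set} → (A → Bool) → List A → List A
keep f []       = []
keep f (x ∷ xs) = if f x then x ∷ keep f xs else keep f xs

range1 : ℕ → List ℕ
range1 n = map suc (upTo n)

words : ℕ → ℕ → List (List ℕ)
words zero    n = [] ∷ []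
words (suc m) n = concatMap (λ v → map (v ∷_) (words m n)) (range1 n)

notIn : ℕ → List ℕ → Bool
notIn v []       = true
notIn v (w ∷ ws) = not (v ≡ᵇ w) ∧ notIn v ws

distinct : List ℕ → Bool
distinct []       = true
distinct (v ∷ vs) = notIn v vs ∧ distinct vs

Sym : ℕ → List (List ℕ)
Sym n = keep distinct (words n n)

-- π_i (1-indexed); default 0 outside range (never used there)
at : List ℕ → ℕ → ℕ
at []       _             = 0
at (v ∷ vs) zero          = 0
at (v ∷ vs) (suc zero)    = v
at (v ∷ vs) (suc (suc i)) = at vs (suc i)

-- A mesh pattern (12, R), R ⊆ {0,1,2}², given as a list of shaded cells (a,b).
Mesh : Set
Mesh = List (Fin 3 × Fin 3)

-- boundaries x₀ = 0, x₁ = i₁, x₂ = i₂, x₃ = n+1 (same shape for y)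
bnd : ℕ → ℕ → ℕ → Fin 4 → ℕ
bnd u v N zero                   = 0
bnd u v N (suc zero)             = u
bnd u v N (suc (suc zero))       = v
bnd u v N (suc (suc (suc zero))) = N

inj₄ : Fin 3 → Fin 4
inj₄ zero             = zero
inj₄ (suc zero)       = suc zero
inj₄ (suc (suc zero)) = suc (suc zero)

btw : ℕ → ℕ → ℕ → Bool
btw lo z hi = (lo <ᵇ z) ∧ (z <ᵇ hi)

isOcc : Mesh → List ℕ → ℕ → ℕ → Bool
isOcc R π i₁ i₂ =
  (i₁ <ᵇ i₂) ∧ (at π i₁ <ᵇ at π i₂) ∧
  all (λ { (a , b) →
      not (any (λ k →
             btw (X (inj₄ a)) k (X (suc a)) ∧
             btw (Y (inj₄ b)) (at π k) (Y (suc b)))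
           (range1 n)) })
    R
  where
    n = length π
    X = bnd i₁ i₂ (suc n)
    Y = bnd (at π i₁) (at π i₂) (suc n)

occ : Mesh → List ℕ → ℕ
occ R π = length (keep (λ { (i , j) → isOcc R π i j })
                   (concatMap (λ i → map (i ,_) (range1 (length π))) (range1 (length π))))

s : ℕ → ℕ → Mesh → ℕ
s n k p = length (keep (λ π → occ p π ≡ᵇ k) (Sym n))

Equidistributed : Mesh → Mesh → Set
Equidistributed p₁ p₂ = ∀ n k → s n k p₁ ≡ s n k p₂

f3 : ℕ → Fin 3
f3 0 = zero
f3 1 = suc zero
f3 _ = suc (suc zero)

c : ℕ → ℕ → Fin 3 × Fin 3
c a b = f3 a , f3 b

pat : Fin 6 → Mesh
pat zero = c 0 2 ∷ c 1 2 ∷ c 2 2 ∷ c 0 1 ∷ c 1 1 ∷ c 2 1 ∷ []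
pat (suc zero) = c 0 2 ∷ c 1 2 ∷ c 0 1 ∷ c 1 1 ∷ c 0 0 ∷ c 1 0 ∷ []
pat (suc (suc zero)) = c 1 2 ∷ c 2 2 ∷ c 1 1 ∷ c 2 1 ∷ c 1 0 ∷ c 2 0 ∷ []
pat (suc (suc (suc zero))) = c 0 1 ∷ c 1 1 ∷ c 2 1 ∷ c 0 0 ∷ c 1 0 ∷ c 2 0 ∷ []
pat (suc (suc (suc (suc zero)))) = c 0 2 ∷ c 2 2 ∷ c 0 1 ∷ c 2 1 ∷ c 0 0 ∷ c 2 0 ∷ []
pat (suc (suc (suc (suc (suc zero))))) = c 0 2 ∷ c 1 2 ∷ c 2 2 ∷ c 0 0 ∷ c 1 0 ∷ c 2 0 ∷ []

{-# OPTIONS --safe #-}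
-- Each of the six patterns shades two whole columns or two whole rows of the diagram of 12.  A fully
-- shaded column (row) contains no position (value) of π strictly between its two walls, so the walls
-- are consecutive integers, and two such strips pin an occurrence down to a single candidate: the
-- positions p < q in {(1,2), (n-1,n), (1,n)} for column patterns, which occur iff π_p < π_q, and the
-- positions of the values u < w in the same three pairs for row patterns, which occur iff u precedes
-- w.  Hence every permutation has 0 or 1 occurrences, and relabelling the values by an involution
-- (complementation v ↦ n+1-v for columns, the transposition (u w) for rows) swaps the two cases, so
-- each happens for exactly n!/2 permutations.  For n < 2 there is no pair of positions at all.
module Submission where

open import Defs
open import Algebra.Bundles using (CommutativeMonoid)
open import Data.Bool using (Bool; true; false; T; not; _∧_; if_then_else_)
open import Data.Bool.Properties using (T-∧; T-≡; ∧-assoc; ∧-commutativeMonoid)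
open import Algebra.Properties.CommutativeSemigroup
  (CommutativeMonoid.commutativeSemigroup ∧-commutativeMonoid) using (interchange)
open import Data.Bool.ListAction using (all; any)
open import Data.Empty using (⊥-elim)
open import Data.Fin using (Fin; zero; suc)
open import Data.List
  using (List; []; _∷_; length; map; concatMap; _++_; upTo; filterᵇ; cartesianProduct)
open import Data.List.Properties
  using (length-++; length-map; length-upTo; map-cong; map-∘; map-concatMap; concatMap-map; concatMap-cong)
open import Data.List.Membership.Propositional using (_∈_; _∉_; lose; find)
import Data.List.Membership.Propositional.Properties as ∈
open import Data.List.Membership.Propositional.Properties.WithK using (unique∧set⇒bag)
open import Data.List.Relation.Binary.BagAndSetEquality as Bag
  using (_∼[_]_; bag; >>=-cong; ∼bag⇒↭; ↭⇒∼bag)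
open import Data.List.Relation.Binary.Permutation.Propositional using (_↭_; ↭-refl)
open import Data.List.Relation.Binary.Permutation.Propositional.Properties using (filter-↭; ↭-length)
open import Data.List.Relation.Binary.Subset.Propositional using (_⊆_)
open import Data.List.Relation.Unary.Any using (here; there)
import Data.List.Relation.Unary.Any.Properties as Any
open import Data.List.Relation.Unary.All as All using (All; []; _∷_)
import Data.List.Relation.Unary.All.Properties as All
open import Data.List.Relation.Unary.Unique.Propositional using (Unique; []; _∷_)
import Data.List.Relation.Unary.Unique.Propositional.Properties as Unique
open import Data.Nat using (ℕ; zero; suc; pred; _+_; _*_; _∸_; _/_; _!; _≤_; _<_)
open import Data.Nat using (_<ᵇ_; _≤ᵇ_; _≡ᵇ_; z≤n; s≤s; z<s; s<s)
open import Data.Nat.Properties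
open import Data.Nat.DivMod using (m*n/n≡m)
open import Data.Nat.ListAction using (sum)
open import Data.List.Membership.DecPropositional _≟_ using (_∈?_)
open import Data.Product using (_×_; _,_; proj₁; proj₂; ∃-syntax)
open import Data.Product.Function.NonDependent.Propositional using (_×-⇔_)
open import Data.Sum using (inj₁; inj₂)
open import Function.Base using (_∘_)
open import Function.Definitions using (Injective)
open import Function.Bundles using (_⇔_; mk⇔; Equivalence)
open import Relation.Binary.Definitions using (tri<; tri≈; tri>)
open import Relation.Binary.PropositionalEquality
open import Relation.Nullary using (¬_; contradiction; yes; no; T?)
open import Relation.Nullary.Reflects using (Reflects; ofʸ; ofⁿ; fromEquivalence)

private variable
  A B : Set
  x : A
  xs ys : List A
  f g : A → Bool

indicator : Bool → ℕ
indicator b = if b then 1 else 0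

indicator-T : ∀ {b} → T b → indicator b ≡ 1
indicator-T {true} _ = refl

T-injective : ∀ {a b} → (T a → T b) → (T b → T a) → a ≡ b
T-injective {true}  {true}  _ _ = refl
T-injective {false} {false} _ _ = refl
T-injective {true}  {false} f _ = ⊥-elim (f _)
T-injective {false} {true}  _ g = ⊥-elim (g _)

T-not : ∀ {b} → T (not b) ⇔ (¬ T b)
T-not {true}  = mk⇔ (λ ()) (λ ¬t → ¬t _)
T-not {false} = mk⇔ (λ _ ()) (λ _ → _)

≡ᵇ-reflects : ∀ m n → Reflects (m ≡ n) (m ≡ᵇ n)
≡ᵇ-reflects m n = fromEquivalence (≡ᵇ⇒≡ m n) (≡⇒≡ᵇ m n)

≡ᵇ-refl : ∀ v → (v ≡ᵇ v) ≡ true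
≡ᵇ-refl v = Equivalence.to T-≡ (≡⇒≡ᵇ v v refl)

≡ᵇ-≢ : ∀ {v w} → v ≢ w → (v ≡ᵇ w) ≡ false
≡ᵇ-≢ {v} {w} v≢w with v ≡ᵇ w | ≡ᵇ-reflects v w
... | true  | ofʸ v≡w = contradiction v≡w v≢w
... | false | _       = refl

≡ᵇ-injective : ∀ {τ} → Injective _≡_ _≡_ τ → ∀ x y → (τ x ≡ᵇ τ y) ≡ (x ≡ᵇ y)
≡ᵇ-injective {τ} τ-injective x y = T-injective
  (≡⇒≡ᵇ x y ∘ τ-injective ∘ ≡ᵇ⇒≡ (τ x) (τ y))
  (≡⇒≡ᵇ (τ x) (τ y) ∘ cong τ ∘ ≡ᵇ⇒≡ x y)

<ᵇ-true : ∀ {x y} → x < y → (x <ᵇ y) ≡ true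
<ᵇ-true x<y = Equivalence.to T-≡ (<⇒<ᵇ x<y)

<ᵇ-false : ∀ {x y} → y ≤ x → (x <ᵇ y) ≡ false
<ᵇ-false {x} {y} y≤x with x <ᵇ y in eq
... | true  = contradiction y≤x (<⇒≱ (<ᵇ⇒< x y (subst T (sym eq) _)))
... | false = refl

<ᵇ-flip : ∀ {x y} → x ≢ y → (y <ᵇ x) ≡ not (x <ᵇ y)
<ᵇ-flip {x} {y} x≢y with <-cmp x y
... | tri< x<y _ _ = trans (<ᵇ-false (<⇒≤ x<y)) (cong not (sym (<ᵇ-true x<y)))
... | tri≈ _ x≡y _ = contradiction x≡y x≢y
... | tri> _ _ y<x = trans (<ᵇ-true y<x) (cong not (sym (<ᵇ-false (<⇒≤ y<x))))

-- Counting with Boolean tests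

count : (A → Bool) → List A → ℕ
count f xs = length (keep f xs)

keep≡filterᵇ : ∀ (f : A → Bool) xs → keep f xs ≡ filterᵇ f xs
keep≡filterᵇ f []       = refl
keep≡filterᵇ f (x ∷ xs) with f x
... | true  = cong (x ∷_) (keep≡filterᵇ f xs)
... | false = keep≡filterᵇ f xs

∈-keep⁻ : ∀ (f : A → Bool) xs → x ∈ keep f xs → x ∈ xs × T (f x)
∈-keep⁻ f xs x∈ = ∈.∈-filter⁻ (T? ∘ f) (subst (_ ∈_) (keep≡filterᵇ f xs) x∈)

count-↭ : ∀ (f : A → Bool) → xs ↭ ys → count f xs ≡ count f ys
count-↭ {xs = xs} {ys} f xs↭ys = begin
  length (keep f xs)     ≡⟨ cong length (keep≡filterᵇ f xs) ⟩
  length (filterᵇ f xs)  ≡⟨ ↭-length (filter-↭ (T? ∘ f) xs↭ys) ⟩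
  length (filterᵇ f ys)  ≡⟨ cong length (keep≡filterᵇ f ys) ⟨
  length (keep f ys)     ∎
  where open ≡-Reasoning

count-cong : ∀ xs → (∀ {x} → x ∈ xs → f x ≡ g x) → count f xs ≡ count g xs
count-cong []       f≡g = refl
count-cong {f = f} {g} (x ∷ xs) f≡g with f x | g x | f≡g (here refl)
... | true  | true  | refl = cong suc (count-cong xs (f≡g ∘ there))
... | false | false | refl = count-cong xs (f≡g ∘ there)

count-none : ∀ xs → (∀ {x} → x ∈ xs → ¬ T (f x)) → count f xs ≡ 0
count-none []       none = refl
count-none {f = f} (x ∷ xs) none with f x | none (here refl)
... | true  | ¬fx = contradiction _ ¬fx
... | false | _   = count-none xs (none ∘ there)

count-∧ˡ : ∀ b (f : A → Bool) xs → count (λ x → b ∧ f x) xs ≡ (if b then count f xs else 0)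
count-∧ˡ true  f xs = refl
count-∧ˡ false f xs = count-none xs λ _ ()

count-true : ∀ (xs : List A) → count (λ _ → true) xs ≡ length xs
count-true []       = refl
count-true (x ∷ xs) = cong suc (count-true xs)

count-map : ∀ (f : B → Bool) (g : A → B) xs → count f (map g xs) ≡ count (f ∘ g) xs
count-map f g []       = refl
count-map f g (x ∷ xs) with f (g x)
... | true  = cong suc (count-map f g xs)
... | false = count-map f g xs

count-keep : ∀ (f g : A → Bool) xs → count f (keep g xs) ≡ count (λ x → g x ∧ f x) xs
count-keep f g []       = refl
count-keep f g (x ∷ xs) with g x
... | false = count-keep f g xs
... | true with f x
...   | true  = cong suc (count-keep f g xs)
...   | false = count-keep f g xs

count-++ : ∀ (f : A → Bool) xs ys → count f (xs ++ ys) ≡ count f xs + count f ys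
count-++ f []       ys = refl
count-++ f (x ∷ xs) ys with f x
... | true  = cong suc (count-++ f xs ys)
... | false = count-++ f xs ys

count-concatMap : ∀ (f : B → Bool) (h : A → List B) xs →
                  count f (concatMap h xs) ≡ sum (map (count f ∘ h) xs)
count-concatMap f h []       = refl
count-concatMap f h (x ∷ xs) =
  trans (count-++ f (h x) (concatMap h xs)) (cong (count f (h x) +_) (count-concatMap f h xs))

count-partition : ∀ (f h : A → Bool) xs →
                  count (λ x → f x ∧ h x) xs + count (λ x → f x ∧ not (h x)) xs ≡ count f xs
count-partition f h []       = refl
count-partition f h (x ∷ xs) with f x | h x
... | true  | true  = cong suc (count-partition f h xs)
... | true  | false = trans (+-suc _ _) (cong suc (count-partition f h xs))
... | false | _     = count-partition f h xs

count-point : ∀ {f : A → Bool} {x xs} → Unique xs → x ∈ xs →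
              (∀ {y} → y ∈ xs → T (f y) → y ≡ x) → count f xs ≡ indicator (f x)
count-point {f = f} {x} (x∉ ∷ _) (here refl) only with f x
... | true  = cong suc (count-none _ λ y∈ fy → All.All¬⇒¬Any x∉ (subst (_∈ _) (only (there y∈) fy) y∈))
... | false =          count-none _ λ y∈ fy → All.All¬⇒¬Any x∉ (subst (_∈ _) (only (there y∈) fy) y∈)
count-point {f = f} {xs = y ∷ _} (y∉ ∷ u) (there x∈) only with f y in fy
... | true  = contradiction (subst (_∈ _) (sym (only (here refl) (subst T (sym fy) _))) x∈)
                            (All.All¬⇒¬Any y∉)
... | false = count-point u x∈ (only ∘ there)

sum-if : ∀ (g : A → Bool) {F : A → ℕ} K xs → (∀ {x} → x ∈ xs → T (g x) → F x ≡ K) →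
         sum (map (λ x → if g x then F x else 0) xs) ≡ count g xs * K
sum-if g K []       F≡K = refl
sum-if g K (x ∷ xs) F≡K with g x in gx
... | true  = cong₂ _+_ (F≡K (here refl) (subst T (sym gx) _)) (sum-if g K xs (F≡K ∘ there))
... | false = sum-if g K xs (F≡K ∘ there)

count-remove : ∀ (g : ℕ → Bool) {A v} → Unique A → v ∈ A → T (g v) →
               count (λ x → g x ∧ not (v ≡ᵇ x)) A ≡ pred (count g A)
count-remove g {A} {v} A-unique v∈A gv = cong pred (begin
  1 + others                               ≡⟨ cong (_+ others) (indicator-T gv∧v≡v) ⟨
  indicator (g v ∧ (v ≡ᵇ v)) + others      ≡⟨ cong (_+ others) (count-point A-unique v∈A only-v) ⟨
  count (λ x → g x ∧ (v ≡ᵇ x)) A + others  ≡⟨ count-partition g (v ≡ᵇ_) A ⟩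
  count g A                                ∎)
  where
  open ≡-Reasoning
  others = count (λ x → g x ∧ not (v ≡ᵇ x)) A
  gv∧v≡v : T (g v ∧ (v ≡ᵇ v))
  gv∧v≡v = Equivalence.from T-∧ (gv , ≡⇒≡ᵇ v v refl)
  only-v : ∀ {y} → y ∈ A → T (g y ∧ (v ≡ᵇ y)) → y ≡ v
  only-v _ t = sym (≡ᵇ⇒≡ v _ (proj₂ (Equivalence.to T-∧ t)))

-- Positions and values

Between : ℕ → ℕ → ℕ → Set
Between lo hi x = lo < x × x < hi

InRange : ℕ → ℕ → Set
InRange n = Between 0 (suc n)

∈-range1 : ∀ {n k} → k ∈ range1 n ⇔ InRange n k
∈-range1 = mk⇔ to from
  where
  to : ∀ {n k} → k ∈ range1 n → InRange n k
  to k∈ with ∈.∈-map⁻ suc k∈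
  ... | _ , k∈upTo , refl = z<s , s≤s (∈.∈-upTo⁻ k∈upTo)
  from : ∀ {n k} → InRange n k → k ∈ range1 n
  from {k = suc k} (_ , s≤s k<n) = ∈.∈-map⁺ suc (∈.∈-upTo⁺ k<n)

range1-unique : ∀ n → Unique (range1 n)
range1-unique n = Unique.map⁺ suc-injective (Unique.upTo⁺ n)

length-range1 : ∀ n → length (range1 n) ≡ n
length-range1 n = trans (length-map suc (upTo n)) (length-upTo n)

T-notIn : ∀ {v} xs → T (notIn v xs) ⇔ v ∉ xs
T-notIn {v} []       = mk⇔ (λ _ ()) _
T-notIn {v} (w ∷ xs) with v ≡ᵇ w | ≡ᵇ-reflects v w
... | true  | ofʸ refl = mk⇔ (λ ()) (λ v∉ → v∉ (here refl))
... | false | ofⁿ v≢w = mk⇔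
  (λ t → λ { (here v≡w) → v≢w v≡w ; (there v∈) → Equivalence.to (T-notIn xs) t v∈ })
  (λ v∉ → Equivalence.from (T-notIn xs) (v∉ ∘ there))

T-distinct : ∀ xs → T (distinct xs) ⇔ Unique xs
T-distinct []       = mk⇔ (λ _ → []) _
T-distinct (x ∷ xs) = mk⇔
  (λ t → let x∉ , rest = Equivalence.to (T-∧ {notIn x xs}) t in
         All.¬Any⇒All¬ xs (Equivalence.to (T-notIn xs) x∉) ∷ Equivalence.to (T-distinct xs) rest)
  (λ { (x∉ ∷ u) → Equivalence.from T-∧
         (Equivalence.from (T-notIn xs) (All.All¬⇒¬Any x∉) , Equivalence.from (T-distinct xs) u) })

distinct-map : ∀ {τ} → Injective _≡_ _≡_ τ → ∀ xs → distinct (map τ xs) ≡ distinct xs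
distinct-map τ-injective []       = refl
distinct-map {τ} τ-injective (x ∷ xs) = cong₂ _∧_ (notIn-map xs) (distinct-map τ-injective xs)
  where
  notIn-map : ∀ ys → notIn (τ x) (map τ ys) ≡ notIn x ys
  notIn-map []       = refl
  notIn-map (y ∷ ys) = cong₂ (λ b c → not b ∧ c) (≡ᵇ-injective τ-injective x y) (notIn-map ys)

at-∈ : ∀ π {k} → InRange (length π) k → at π k ∈ π
at-∈ []      {1}           (_ , s≤s ())
at-∈ (v ∷ π) {1}           _             = here refl
at-∈ (v ∷ π) {suc (suc k)} (_ , s≤s k<) = there (at-∈ π (z<s , k<))

at-injective : ∀ {π k l} → Unique π → InRange (length π) k → InRange (length π) l →
               at π k ≡ at π l → k ≡ l
at-injective {[]}    {1}           _        (_ , s≤s ())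
at-injective {v ∷ π} {1}           {1}           _        _             _             _  = refl
at-injective {v ∷ π} {1}           {suc (suc l)} (v∉ ∷ _) _             (_ , s≤s l<) eq =
  contradiction (subst (_∈ π) (sym eq) (at-∈ π (z<s , l<))) (All.All¬⇒¬Any v∉)
at-injective {v ∷ π} {suc (suc k)} {1}           (v∉ ∷ _) (_ , s≤s k<) _             eq =
  contradiction (subst (_∈ π) eq (at-∈ π (z<s , k<))) (All.All¬⇒¬Any v∉)
at-injective {v ∷ π} {suc (suc k)} {suc (suc l)} (_ ∷ u)  (_ , s≤s k<) (_ , s≤s l<) eq =
  cong suc (at-injective u (z<s , k<) (z<s , l<) eq)

at-map : ∀ (τ : ℕ → ℕ) π {k} → InRange (length π) k → at (map τ π) k ≡ τ (at π k)
at-map τ []      {1}           (_ , s≤s ())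
at-map τ (v ∷ π) {1}           _             = refl
at-map τ (v ∷ π) {suc (suc k)} (_ , s≤s k<) = at-map τ π (z<s , k<)

positionOf : ℕ → List ℕ → ℕ
positionOf v []       = 0
positionOf v (x ∷ xs) = if v ≡ᵇ x then 1 else suc (positionOf v xs)

positionOf-range : ∀ {v π} → v ∈ π → InRange (length π) (positionOf v π)
positionOf-range {v} {x ∷ π} v∈ with v ≡ᵇ x | ≡ᵇ-reflects v x | v∈
... | true  | _      | _          = z<s , s≤s z<s
... | false | ofⁿ v≢ | here v≡    = contradiction v≡ v≢
... | false | _      | there v∈π = z<s , s≤s (proj₂ (positionOf-range v∈π))

at-positionOf : ∀ {v π} → v ∈ π → at π (positionOf v π) ≡ v
at-positionOf {v} {x ∷ π} v∈ with v ≡ᵇ x | ≡ᵇ-reflects v x | v∈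
... | true  | ofʸ v≡ | _          = sym v≡
... | false | ofⁿ v≢ | here v≡    = contradiction v≡ v≢
... | false | _      | there v∈π with positionOf v π | positionOf-range v∈π | at-positionOf v∈π
...   | suc _ | _ | at-position≡v = at-position≡v

positionOf-map : ∀ {τ} → Injective _≡_ _≡_ τ → ∀ v π → positionOf (τ v) (map τ π) ≡ positionOf v π
positionOf-map τ-injective v []       = refl
positionOf-map τ-injective v (x ∷ π) rewrite ≡ᵇ-injective τ-injective v x with v ≡ᵇ x
... | true  = refl
... | false = cong suc (positionOf-map τ-injective v π)

-- Permutations

unique-⊆⇒length≤ : ∀ {xs ys : List A} → Unique xs → xs ⊆ ys → length xs ≤ length ys
unique-⊆⇒length≤ {xs = []}     _        _     = z≤n
unique-⊆⇒length≤ {xs = x ∷ xs} (x∉ ∷ u) x∷xs⊆ with ∈.∈-∃++ (x∷xs⊆ (here refl))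
... | ys , zs , refl = begin
  suc (length xs)              ≤⟨ s≤s (unique-⊆⇒length≤ u xs⊆) ⟩
  suc (length (ys ++ zs))      ≡⟨ cong suc (length-++ ys) ⟩
  suc (length ys + length zs)  ≡⟨ +-suc (length ys) (length zs) ⟨
  length ys + length (x ∷ zs)  ≡⟨ length-++ ys ⟨
  length (ys ++ x ∷ zs)        ∎
  where
  open ≤-Reasoning
  xs⊆ : xs ⊆ ys ++ zs
  xs⊆ y∈ with ∈.∈-++⁻ ys (x∷xs⊆ (there y∈))
  ... | inj₁ y∈ys         = ∈.∈-++⁺ˡ y∈ys
  ... | inj₂ (here refl)  = contradiction y∈ (All.All¬⇒¬Any x∉)
  ... | inj₂ (there y∈zs) = ∈.∈-++⁺ʳ ys y∈zs

record IsPermutation (π : List ℕ) : Set where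
  field
    unique : Unique π
    range  : ∀ {v} → v ∈ π → InRange (length π) v

  -- A missing value v would make v ∷ π a duplicate-free list of n + 1 elements of [1..n].
  surjective : ∀ {v} → InRange (length π) v → v ∈ π
  surjective {v} v-range with v ∈? π
  ... | yes v∈ = v∈
  ... | no  v∉ = contradiction too-long (<-irrefl refl)
    where
    too-long : suc (length π) ≤ length π
    too-long = subst (suc (length π) ≤_) (length-range1 (length π))
      (unique-⊆⇒length≤ (All.¬Any⇒All¬ π v∉ ∷ unique) λ
        { (here refl) → Equivalence.from ∈-range1 v-range
        ; (there w∈)  → Equivalence.from ∈-range1 (range w∈) })

wordsOver : ℕ → List ℕ → List (List ℕ)
wordsOver zero    A = [] ∷ []
wordsOver (suc m) A = concatMap (λ v → map (v ∷_) (wordsOver m A)) A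

words≡wordsOver : ∀ m n → words m n ≡ wordsOver m (range1 n)
words≡wordsOver zero    n = refl
words≡wordsOver (suc m) n =
  cong (λ W → concatMap (λ v → map (v ∷_) W) (range1 n)) (words≡wordsOver m n)

wordsOver-shape : ∀ m A → All (λ w → length w ≡ m × w ⊆ A) (wordsOver m A)
wordsOver-shape zero    A = (refl , λ ()) ∷ []
wordsOver-shape (suc m) A = All.concat⁺ (All.map⁺ (All.tabulate λ v∈A →
  All.map⁺ (All.map (λ (len , w⊆A) → cong suc len , λ { (here refl) → v∈A ; (there x∈) → w⊆A x∈ })
                    (wordsOver-shape m A))))

∈-Sym⁻ : ∀ {n π} → π ∈ Sym n → length π ≡ n × IsPermutation π
∈-Sym⁻ {n} {π} π∈ with ∈-keep⁻ distinct (words n n) π∈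
... | π∈words , π-distinct
  with All.lookup (wordsOver-shape n (range1 n)) (subst (π ∈_) (words≡wordsOver n n) π∈words)
...   | refl , π⊆ = refl , record
  { unique = Equivalence.to (T-distinct π) π-distinct
  ; range  = Equivalence.to ∈-range1 ∘ π⊆
  }

fallingFactorial : ℕ → ℕ → ℕ
fallingFactorial k zero    = 1
fallingFactorial k (suc m) = k * fallingFactorial (pred k) m

fallingFactorial-! : ∀ n → fallingFactorial n n ≡ n !
fallingFactorial-! zero    = refl
fallingFactorial-! (suc n) = cong (suc n *_) (fallingFactorial-! n)

all-∧-notIn : ∀ (g : ℕ → Bool) v w → all g w ∧ notIn v w ≡ all (λ x → g x ∧ not (v ≡ᵇ x)) w
all-∧-notIn g v []      = refl
all-∧-notIn g v (x ∷ w) =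
  trans (interchange (g x) (all g w) (not (v ≡ᵇ x)) (notIn v w)) (cong (_ ∧_) (all-∧-notIn g v w))

-- Generalised to an arbitrary filter g of the alphabet so that the induction goes through.
count-injectiveWords : ∀ (g : ℕ → Bool) {A} → Unique A → ∀ m →
  count (λ w → all g w ∧ distinct w) (wordsOver m A) ≡ fallingFactorial (count g A) m
count-injectiveWords g A-unique zero = refl
count-injectiveWords g {A} A-unique (suc m) = begin
  count P (concatMap (λ v → map (v ∷_) W) A)   ≡⟨ count-concatMap P (λ v → map (v ∷_) W) A ⟩
  sum (map (λ v → count P (map (v ∷_) W)) A)  ≡⟨ cong sum (map-cong words-from A) ⟩
  sum (map (λ v → if g v then fallingFactorial (count (without v) A) m else 0) A)
    ≡⟨ sum-if g _ A (λ v∈A gv → cong (λ k → fallingFactorial k m) (count-remove g A-unique v∈A gv)) ⟩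
  count g A * fallingFactorial (pred (count g A)) m ∎
  where
  open ≡-Reasoning
  P = λ w → all g w ∧ distinct w
  W = wordsOver m A
  without : ℕ → ℕ → Bool
  without v x = g x ∧ not (v ≡ᵇ x)
  fresh : ∀ v w → (g v ∧ all g w) ∧ (notIn v w ∧ distinct w) ≡ g v ∧ (all (without v) w ∧ distinct w)
  fresh v w = begin
    (g v ∧ all g w) ∧ (notIn v w ∧ distinct w)  ≡⟨ ∧-assoc (g v) _ _ ⟩
    g v ∧ (all g w ∧ (notIn v w ∧ distinct w))  ≡⟨ cong (g v ∧_) (∧-assoc (all g w) _ _) ⟨
    g v ∧ ((all g w ∧ notIn v w) ∧ distinct w)
      ≡⟨ cong (λ b → g v ∧ (b ∧ distinct w)) (all-∧-notIn g v w) ⟩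
    g v ∧ (all (without v) w ∧ distinct w)      ∎
  words-from : ∀ v → count P (map (v ∷_) W) ≡ (if g v then fallingFactorial (count (without v) A) m else 0)
  words-from v = begin
    count P (map (v ∷_) W)                                      ≡⟨ count-map P (v ∷_) W ⟩
    count (λ w → (g v ∧ all g w) ∧ (notIn v w ∧ distinct w)) W  ≡⟨ count-cong W (λ {w} _ → fresh v w) ⟩
    count (λ w → g v ∧ (all (without v) w ∧ distinct w)) W      ≡⟨ count-∧ˡ (g v) _ W ⟩
    (if g v then count (λ w → all (without v) w ∧ distinct w) W else 0)
      ≡⟨ cong (λ k → if g v then k else 0) (count-injectiveWords (without v) A-unique m) ⟩
    (if g v then fallingFactorial (count (without v) A) m else 0) ∎

length-Sym : ∀ n → length (Sym n) ≡ n !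
length-Sym n = begin
  count distinct (words n n)
    ≡⟨ count-cong (words n n) (λ {w} _ → cong (_∧ distinct w) (sym (all-true w))) ⟩
  count (λ w → all (λ _ → true) w ∧ distinct w) (words n n)
    ≡⟨ cong (count _) (words≡wordsOver n n) ⟩
  count (λ w → all (λ _ → true) w ∧ distinct w) (wordsOver n (range1 n))
    ≡⟨ count-injectiveWords _ (range1-unique n) n ⟩
  fallingFactorial (count (λ _ → true) (range1 n)) n
    ≡⟨ cong (λ k → fallingFactorial k n) (trans (count-true (range1 n)) (length-range1 n)) ⟩
  fallingFactorial n n
    ≡⟨ fallingFactorial-! n ⟩
  n ! ∎
  where
  open ≡-Reasoning
  all-true : ∀ (w : List ℕ) → all (λ _ → true) w ≡ true
  all-true []      = refl
  all-true (x ∷ w) = all-true w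

map-wordsOver : ∀ (τ : ℕ → ℕ) m A → map (map τ) (wordsOver m A) ≡ wordsOver m (map τ A)
map-wordsOver τ zero    A = refl
map-wordsOver τ (suc m) A = begin
  map (map τ) (concatMap (λ v → map (v ∷_) (wordsOver m A)) A)
    ≡⟨ map-concatMap (map τ) _ A ⟩
  concatMap (λ v → map (map τ) (map (v ∷_) (wordsOver m A))) A
    ≡⟨ concatMap-cong (λ v → trans (sym (map-∘ (wordsOver m A))) (map-∘ (wordsOver m A))) A ⟩
  concatMap (λ v → map (τ v ∷_) (map (map τ) (wordsOver m A))) A
    ≡⟨ cong (λ W → concatMap (λ v → map (τ v ∷_) W) A) (map-wordsOver τ m A) ⟩
  concatMap (λ v → map (τ v ∷_) (wordsOver m (map τ A))) A
    ≡⟨ concatMap-map (λ u → map (u ∷_) (wordsOver m (map τ A))) τ A ⟨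
  concatMap (λ u → map (u ∷_) (wordsOver m (map τ A))) (map τ A) ∎
  where open ≡-Reasoning

wordsOver-cong : ∀ m {A B} → A ∼[ bag ] B → wordsOver m A ∼[ bag ] wordsOver m B
wordsOver-cong zero    _   = ↭⇒∼bag ↭-refl
wordsOver-cong (suc m) A≈B = >>=-cong A≈B λ v → Bag.map-cong (λ _ → refl) (wordsOver-cong m A≈B)

involutive⇒injective : ∀ {τ : ℕ → ℕ} → (∀ x → τ (τ x) ≡ x) → Injective _≡_ _≡_ τ
involutive⇒injective {τ} τ-involutive {x} {y} eq =
  trans (sym (τ-involutive x)) (trans (cong τ eq) (τ-involutive y))

module Relabel {n : ℕ} {τ : ℕ → ℕ} (τ-involutive : ∀ x → τ (τ x) ≡ x)
               (τ-range : ∀ {x} → InRange n x → InRange n (τ x)) where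

  private
    τ-injective : Injective _≡_ _≡_ τ
    τ-injective = involutive⇒injective τ-involutive

    map-range1 : map τ (range1 n) ∼[ bag ] range1 n
    map-range1 =
      unique∧set⇒bag (Unique.map⁺ τ-injective (range1-unique n)) (range1-unique n) (mk⇔ to from)
      where
      to : ∀ {x} → x ∈ map τ (range1 n) → x ∈ range1 n
      to x∈ with ∈.∈-map⁻ τ x∈
      ... | y , y∈ , refl = Equivalence.from ∈-range1 (τ-range (Equivalence.to ∈-range1 y∈))
      from : ∀ {x} → x ∈ range1 n → x ∈ map τ (range1 n)
      from {x} x∈ = subst (_∈ _) (τ-involutive x)
        (∈.∈-map⁺ τ (Equivalence.from ∈-range1 (τ-range (Equivalence.to ∈-range1 x∈))))

  count-Sym-relabel : ∀ (f : List ℕ → Bool) → count (f ∘ map τ) (Sym n) ≡ count f (Sym n)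
  count-Sym-relabel f = begin
    count (f ∘ map τ) (keep distinct (words n n))
      ≡⟨ count-keep _ distinct (words n n) ⟩
    count (λ w → distinct w ∧ f (map τ w)) (words n n)
      ≡⟨ count-cong (words n n) (λ {w} _ → cong (_∧ f (map τ w)) (sym (distinct-map τ-injective w))) ⟩
    count (λ w → distinct (map τ w) ∧ f (map τ w)) (words n n)
      ≡⟨ count-map P (map τ) (words n n) ⟨
    count P (map (map τ) (words n n))
      ≡⟨ cong (count P ∘ map (map τ)) (words≡wordsOver n n) ⟩
    count P (map (map τ) (wordsOver n (range1 n)))
      ≡⟨ cong (count P) (map-wordsOver τ n (range1 n)) ⟩
    count P (wordsOver n (map τ (range1 n)))
      ≡⟨ count-↭ P (∼bag⇒↭ (wordsOver-cong n map-range1)) ⟩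
    count P (wordsOver n (range1 n))
      ≡⟨ cong (count P) (words≡wordsOver n n) ⟨
    count P (words n n)
      ≡⟨ count-keep f distinct (words n n) ⟨
    count f (keep distinct (words n n)) ∎
    where
    open ≡-Reasoning
    P = λ w → distinct w ∧ f w

halfDistribution : ℕ → ℕ → ℕ
halfDistribution n 0             = n ! / 2
halfDistribution n 1             = n ! / 2
halfDistribution n (suc (suc k)) = 0

double-half : ∀ {m} x → x + x ≡ m → m / 2 ≡ x
double-half x refl =
  trans (cong (_/ 2) (trans (cong (x +_) (sym (+-identityʳ x))) (*-comm 2 x))) (m*n/n≡m x 2)

s≡halfDistribution : ∀ {n} {τ : ℕ → ℕ} →
  (∀ x → τ (τ x) ≡ x) → (∀ {x} → InRange n x → InRange n (τ x)) →
  ∀ (R : Mesh) (occurs : List ℕ → Bool) →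
  (∀ {π} → π ∈ Sym n → occ R π ≡ indicator (occurs π)) →
  (∀ {π} → π ∈ Sym n → occurs (map τ π) ≡ not (occurs π)) →
  ∀ k → s n k R ≡ halfDistribution n k
s≡halfDistribution {n} {τ} τ-involutive τ-range R occurs occ≡ toggles k =
  trans (count-cong (Sym n) (λ π∈ → cong (_≡ᵇ k) (occ≡ π∈))) (by-k k)
  where
  open ≡-Reasoning
  open Relabel τ-involutive τ-range
  balanced : count (not ∘ occurs) (Sym n) ≡ count occurs (Sym n)
  balanced = begin
    count (not ∘ occurs) (Sym n)    ≡⟨ count-cong (Sym n) (sym ∘ toggles) ⟩
    count (occurs ∘ map τ) (Sym n)  ≡⟨ count-Sym-relabel occurs ⟩
    count occurs (Sym n)            ∎
  half : n ! / 2 ≡ count occurs (Sym n)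
  half = double-half (count occurs (Sym n)) (begin
    count occurs (Sym n) + count occurs (Sym n)          ≡⟨ cong (count occurs (Sym n) +_) balanced ⟨
    count occurs (Sym n) + count (not ∘ occurs) (Sym n)  ≡⟨ count-partition (λ _ → true) occurs (Sym n) ⟩
    count (λ _ → true) (Sym n)                           ≡⟨ count-true (Sym n) ⟩
    length (Sym n)                                       ≡⟨ length-Sym n ⟩
    n !                                                  ∎)
  by-k : ∀ k → count (λ π → indicator (occurs π) ≡ᵇ k) (Sym n) ≡ halfDistribution n k
  by-k 0             = trans (count-cong (Sym n) λ {π} _ → indicator≡ᵇ0 (occurs π)) (trans balanced (sym half))
    where
    indicator≡ᵇ0 : ∀ b → (indicator b ≡ᵇ 0) ≡ not b
    indicator≡ᵇ0 true  = refl
    indicator≡ᵇ0 false = refl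
  by-k 1             = trans (count-cong (Sym n) λ {π} _ → indicator≡ᵇ1 (occurs π)) (sym half)
    where
    indicator≡ᵇ1 : ∀ b → (indicator b ≡ᵇ 1) ≡ b
    indicator≡ᵇ1 true  = refl
    indicator≡ᵇ1 false = refl
  by-k (suc (suc k)) = count-none (Sym n) λ {π} _ → indicator≢2+ (occurs π)
    where
    indicator≢2+ : ∀ b → ¬ T (indicator b ≡ᵇ suc (suc k))
    indicator≢2+ true  ()
    indicator≢2+ false ()

-- Occurrences of mesh patterns (12, R)

InStrip : ℕ → ℕ → ℕ → Fin 3 → ℕ → Set
InStrip p q N a = Between (bnd p q N (inj₄ a)) (bnd p q N (suc a))

NarrowStrip : ℕ → ℕ → ℕ → Fin 3 → Set
NarrowStrip p q N a = bnd p q N (suc a) ≡ suc (bnd p q N (inj₄ a))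

OrderedPair : ℕ → ℕ → ℕ → Set
OrderedPair N p q = 0 < p × p < q × q < N

strip-of : ∀ {p q N x} → p < q → Between 0 N x → x ≢ p → x ≢ q → ∃[ a ] InStrip p q N a x
strip-of {p} {q} {x = x} p<q (0<x , x<N) x≢p x≢q with <-cmp x p
... | tri< x<p _ _   = zero , 0<x , x<p
... | tri≈ _ x≡p _   = contradiction x≡p x≢p
... | tri> _ _ p<x with <-cmp x q
...   | tri< x<q _ _ = suc zero , p<x , x<q
...   | tri≈ _ x≡q _ = contradiction x≡q x≢q
...   | tri> _ _ q<x = suc (suc zero) , q<x , x<N

strip-avoids : ∀ {p q N x} a → p < q → InStrip p q N a x → x ≢ p × x ≢ q
strip-avoids zero             p<q (_ , x<p)   = <⇒≢ x<p , <⇒≢ (<-trans x<p p<q)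
strip-avoids (suc zero)       p<q (p<x , x<q) = ≢-sym (<⇒≢ p<x) , <⇒≢ x<q
strip-avoids (suc (suc zero)) p<q (q<x , _)   = ≢-sym (<⇒≢ (<-trans p<q q<x)) , ≢-sym (<⇒≢ q<x)

narrow⇒empty : ∀ {p q N x} a → NarrowStrip p q N a → ¬ InStrip p q N a x
narrow⇒empty a narrow (lo<x , x<hi) = <⇒≱ lo<x (≤-pred (subst (_ <_) narrow x<hi))

empty⇒narrow : ∀ {p q N} a → OrderedPair N p q → (∀ {x} → Between 0 N x → ¬ InStrip p q N a x) →
               NarrowStrip p q N a
empty⇒narrow {p} {q} {N} a (0<p , p<q , q<N) empty = ≤-antisym (≮⇒≥ no-interior) (proj₁ (walls a))
  where
  walls : ∀ a → bnd p q N (inj₄ a) < bnd p q N (suc a) × bnd p q N (suc a) ≤ N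
  walls zero             = 0<p , <⇒≤ (<-trans p<q q<N)
  walls (suc zero)       = p<q , <⇒≤ q<N
  walls (suc (suc zero)) = q<N , ≤-refl
  no-interior : ¬ suc (bnd p q N (inj₄ a)) < bnd p q N (suc a)
  no-interior inside = empty (z<s , <-≤-trans inside (proj₂ (walls a))) (n<1+n _ , inside)

boxEmpty : List ℕ → ℕ → ℕ → ℕ → ℕ → Bool
boxEmpty π xl xh yl yh = not (any (λ k → btw xl k xh ∧ btw yl (at π k) yh) (range1 (length π)))

-- Verbatim the cell test inside isOcc, so that T-isOcc holds by unfolding.
cellEmpty : List ℕ → ℕ → ℕ → Fin 3 × Fin 3 → Bool
cellEmpty π i j (a , b) = boxEmpty π (X (inj₄ a)) (X (suc a)) (Y (inj₄ b)) (Y (suc b))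
  where
  X = bnd i j (suc (length π))
  Y = bnd (at π i) (at π j) (suc (length π))

T-btw : ∀ {lo x hi} → T (btw lo x hi) ⇔ Between lo hi x
T-btw {lo} {x} {hi} = mk⇔
  (λ t → let l , h = Equivalence.to T-∧ t in <ᵇ⇒< lo x l , <ᵇ⇒< x hi h)
  (λ (l , h) → Equivalence.from T-∧ (<⇒<ᵇ l , <⇒<ᵇ h))

T-boxEmpty : ∀ π {xl xh yl yh} → T (boxEmpty π xl xh yl yh) ⇔
             (∀ {k} → InRange (length π) k → Between xl xh k → ¬ Between yl yh (at π k))
T-boxEmpty π {xl} {xh} {yl} {yh} = mk⇔
  (λ t {k} k-range x∈ y∈ → Equivalence.to T-not t (Any.any⁺ p (lose (Equivalence.from ∈-range1 k-range)
     (Equivalence.from T-∧ (Equivalence.from T-btw x∈ , Equivalence.from T-btw y∈)))))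
  (λ empty → Equivalence.from T-not λ t →
     let k , k∈ , pk = find (Any.any⁻ p _ t)
         x∈ , y∈     = Equivalence.to T-∧ pk
     in empty (Equivalence.to ∈-range1 k∈) (Equivalence.to T-btw x∈) (Equivalence.to T-btw y∈))
  where
  p = λ k → btw xl k xh ∧ btw yl (at π k) yh

T-cellEmpty : ∀ π {i j} a b → T (cellEmpty π i j (a , b)) ⇔
  (∀ {k} → InRange (length π) k → InStrip i j (suc (length π)) a k →
           ¬ InStrip (at π i) (at π j) (suc (length π)) b (at π k))
T-cellEmpty π a b = T-boxEmpty π

T-isOcc : ∀ R π {i j} → T (isOcc R π i j) ⇔ (i < j × at π i < at π j × All (T ∘ cellEmpty π i j) R)
T-isOcc R π {i} {j} = mk⇔
  (λ t → let i<j , rest     = Equivalence.to T-∧ t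
             πi<πj , cells = Equivalence.to T-∧ rest
         in <ᵇ⇒< i j i<j , <ᵇ⇒< _ _ πi<πj , All.all⁺ (cellEmpty π i j) R cells)
  (λ (i<j , πi<πj , cells) →
     Equivalence.from T-∧ (<⇒<ᵇ i<j , Equivalence.from T-∧ (<⇒<ᵇ πi<πj , All.all⁻ (cellEmpty π i j) cells)))

pairs≡cartesianProduct : ∀ (xs : List A) (ys : List B) →
                         concatMap (λ x → map (x ,_) ys) xs ≡ cartesianProduct xs ys
pairs≡cartesianProduct []       ys = refl
pairs≡cartesianProduct (x ∷ xs) ys = cong (map (x ,_) ys ++_) (pairs≡cartesianProduct xs ys)

occ-single : ∀ R π {p q} → InRange (length π) p → InRange (length π) q →
  (∀ {i j} → InRange (length π) i → InRange (length π) j → T (isOcc R π i j) → (i , j) ≡ (p , q)) →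
  occ R π ≡ indicator (isOcc R π p q)
occ-single R π {p} {q} p-range q-range only = begin
  count occurs (concatMap (λ i → map (i ,_) L) L)  ≡⟨ cong (count occurs) (pairs≡cartesianProduct L L) ⟩
  count occurs (cartesianProduct L L)
    ≡⟨ count-point (Unique.cartesianProduct⁺ (range1-unique (length π)) (range1-unique (length π)))
                   (∈.∈-cartesianProduct⁺ (in-L p-range) (in-L q-range)) only-pq ⟩
  indicator (isOcc R π p q)                        ∎
  where
  open ≡-Reasoning
  L = range1 (length π)
  occurs : ℕ × ℕ → Bool
  occurs (i , j) = isOcc R π i j
  in-L : ∀ {k} → InRange (length π) k → k ∈ L
  in-L = Equivalence.from ∈-range1
  only-pq : ∀ {ij} → ij ∈ cartesianProduct L L → T (occurs ij) → ij ≡ (p , q)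
  only-pq ij∈ = let i∈ , j∈ = ∈.∈-cartesianProduct⁻ L L ij∈ in
                only (Equivalence.to ∈-range1 i∈) (Equivalence.to ∈-range1 j∈)

data StripPair : Set where
  first-two last-two outer-two : StripPair

strips : StripPair → Fin 3 × Fin 3
strips first-two = zero , suc zero
strips last-two  = suc zero , suc (suc zero)
strips outer-two = zero , suc (suc zero)

extremes : StripPair → ℕ → ℕ × ℕ
extremes first-two n = 1 , 2
extremes last-two  n = pred n , n
extremes outer-two n = 1 , n

BothNarrow : StripPair → ℕ → ℕ × ℕ → Set
BothNarrow S N (p , q) = NarrowStrip p q N (proj₁ (strips S)) × NarrowStrip p q N (proj₂ (strips S))

both-narrow⇔extremes : ∀ S {n p q} → OrderedPair (suc n) p q →
                       BothNarrow S (suc n) (p , q) ⇔ ((p , q) ≡ extremes S n)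
both-narrow⇔extremes first-two _ = mk⇔ (λ { (refl , refl) → refl }) (λ { refl → refl , refl })
both-narrow⇔extremes last-two  (0<p , _) = mk⇔ (λ { (refl , refl) → refl }) (from 0<p)
  where
  from : ∀ {n p q} → 0 < p → (p , q) ≡ (pred n , n) → BothNarrow last-two (suc n) (p , q)
  from {suc n} _ refl = refl , refl
both-narrow⇔extremes outer-two _ = mk⇔ (λ { (refl , refl) → refl }) (λ { refl → refl , refl })

extremes-ordered : ∀ S {n} → 2 ≤ n → OrderedPair (suc n) (proj₁ (extremes S n)) (proj₂ (extremes S n))
extremes-ordered first-two (s≤s (s≤s 0≤n)) = z<s , s<s z<s , s<s (s<s (s≤s 0≤n))
extremes-ordered last-two  (s≤s (s≤s _))   = z<s , ≤-refl , ≤-refl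
extremes-ordered outer-two (s≤s 1≤n)       = z<s , s≤s 1≤n , ≤-refl

ordered⇒inRange : ∀ {n p q} → OrderedPair (suc n) p q → InRange n p × InRange n q
ordered⇒inRange (0<p , p<q , q<N) = (0<p , <-trans p<q q<N) , (<-trans 0<p p<q , q<N)

data Orientation : Set where
  columns rows : Orientation

anchor : Orientation → List ℕ → ℕ → ℕ → ℕ × ℕ
anchor columns π i j = i , j
anchor rows    π i j = at π i , at π j

Shaded : (Fin 3 × Fin 3 → Set) → Orientation × StripPair → Set
Shaded P (columns , S) = (∀ b → P (proj₁ (strips S) , b)) × (∀ b → P (proj₂ (strips S) , b))
Shaded P (rows    , S) = (∀ a → P (a , proj₁ (strips S))) × (∀ a → P (a , proj₂ (strips S)))

module Occurrences {π : List ℕ} (perm : IsPermutation π) where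
  open IsPermutation perm

  private
    n = length π

  column-empty⇔narrow : ∀ {i j} a → InRange n i → InRange n j → i < j → at π i < at π j →
    (∀ b → T (cellEmpty π i j (a , b))) ⇔ NarrowStrip i j (suc n) a
  column-empty⇔narrow {i} {j} a i-range@(0<i , _) j-range@(_ , j<N) i<j πi<πj = mk⇔
    (λ cells → empty⇒narrow a (0<i , i<j , j<N) λ {k} k-range k∈ →
      let k≢i , k≢j = strip-avoids a i<j k∈
          b , πk∈   = strip-of πi<πj (range (at-∈ π k-range))
                        (k≢i ∘ at-injective unique k-range i-range) (k≢j ∘ at-injective unique k-range j-range)
      in Equivalence.to (T-cellEmpty π a b) (cells b) k-range k∈ πk∈)
    (λ narrow b → Equivalence.from (T-cellEmpty π a b) λ _ k∈ _ → narrow⇒empty a narrow k∈)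

  row-empty⇔narrow : ∀ {i j} b → InRange n i → InRange n j → i < j → at π i < at π j →
    (∀ a → T (cellEmpty π i j (a , b))) ⇔ NarrowStrip (at π i) (at π j) (suc n) b
  row-empty⇔narrow {i} {j} b i-range j-range i<j πi<πj = mk⇔
    (λ cells → empty⇒narrow b (proj₁ (range (at-∈ π i-range)) , πi<πj , proj₂ (range (at-∈ π j-range)))
      λ {v} v-range v∈ →
      let v≢πi , v≢πj = strip-avoids b πi<πj v∈
          v∈π         = surjective v-range
          at-k≡v      = at-positionOf v∈π
          k-range     = positionOf-range v∈π
          a , k∈      = strip-of i<j k-range
                          (λ k≡i → v≢πi (trans (sym at-k≡v) (cong (at π) k≡i)))
                          (λ k≡j → v≢πj (trans (sym at-k≡v) (cong (at π) k≡j)))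
      in Equivalence.to (T-cellEmpty π a b) (cells a) k-range k∈ (subst (InStrip _ _ _ b) (sym at-k≡v) v∈))
    (λ narrow a → Equivalence.from (T-cellEmpty π a b) λ _ _ πk∈ → narrow⇒empty b narrow πk∈)

  anchor-ordered : ∀ o {i j} → InRange n i → InRange n j → i < j → at π i < at π j →
                   OrderedPair (suc n) (proj₁ (anchor o π i j)) (proj₂ (anchor o π i j))
  anchor-ordered columns (0<i , _) (_ , j<N) i<j _     = 0<i , i<j , j<N
  anchor-ordered rows    i-range   j-range   _   πi<πj =
    proj₁ (range (at-∈ π i-range)) , πi<πj , proj₂ (range (at-∈ π j-range))

  shaded⇔narrow : ∀ o S {i j} → InRange n i → InRange n j → i < j → at π i < at π j →
                  Shaded (T ∘ cellEmpty π i j) (o , S) ⇔ BothNarrow S (suc n) (anchor o π i j)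
  shaded⇔narrow columns S i-range j-range i<j πi<πj =
    column-empty⇔narrow _ i-range j-range i<j πi<πj ×-⇔ column-empty⇔narrow _ i-range j-range i<j πi<πj
  shaded⇔narrow rows    S i-range j-range i<j πi<πj =
    row-empty⇔narrow _ i-range j-range i<j πi<πj ×-⇔ row-empty⇔narrow _ i-range j-range i<j πi<πj

  isOcc⇔anchored : ∀ R o S →
    (∀ {i j} → All (T ∘ cellEmpty π i j) R ⇔ Shaded (T ∘ cellEmpty π i j) (o , S)) →
    ∀ {i j} → InRange n i → InRange n j →
    T (isOcc R π i j) ⇔ (i < j × at π i < at π j × anchor o π i j ≡ extremes S n)
  isOcc⇔anchored R o S R-shape i-range j-range = mk⇔
    (λ t → let i<j , πi<πj , cells = Equivalence.to (T-isOcc R π) t in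
      i<j , πi<πj , Equivalence.to (both-narrow⇔extremes S (anchor-ordered o i-range j-range i<j πi<πj))
                      (Equivalence.to (shaded⇔narrow o S i-range j-range i<j πi<πj) (Equivalence.to R-shape cells)))
    (λ (i<j , πi<πj , anchored) → Equivalence.from (T-isOcc R π) (i<j , πi<πj ,
      Equivalence.from R-shape (Equivalence.from (shaded⇔narrow o S i-range j-range i<j πi<πj)
        (Equivalence.from (both-narrow⇔extremes S (anchor-ordered o i-range j-range i<j πi<πj)) anchored))))

  occ-columns : ∀ R S →
    (∀ {i j} → All (T ∘ cellEmpty π i j) R ⇔ Shaded (T ∘ cellEmpty π i j) (columns , S)) → 2 ≤ n →
    occ R π ≡ indicator (at π (proj₁ (extremes S n)) <ᵇ at π (proj₂ (extremes S n)))
  occ-columns R S R-shape 2≤n = trans (occ-single R π p-range q-range only) (cong indicator at-extremes)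
    where
    p = proj₁ (extremes S n)
    q = proj₂ (extremes S n)
    ordered  = extremes-ordered S 2≤n
    p-range  = proj₁ (ordered⇒inRange ordered)
    q-range  = proj₂ (ordered⇒inRange ordered)
    anchored = isOcc⇔anchored R columns S R-shape
    only : ∀ {i j} → InRange n i → InRange n j → T (isOcc R π i j) → (i , j) ≡ (p , q)
    only i-range j-range t = proj₂ (proj₂ (Equivalence.to (anchored i-range j-range) t))
    at-extremes : isOcc R π p q ≡ (at π p <ᵇ at π q)
    at-extremes = T-injective
      (λ t → <⇒<ᵇ (proj₁ (proj₂ (Equivalence.to (anchored p-range q-range) t))))
      (λ t → Equivalence.from (anchored p-range q-range) (proj₁ (proj₂ ordered) , <ᵇ⇒< _ _ t , refl))

  occ-rows : ∀ R S →
    (∀ {i j} → All (T ∘ cellEmpty π i j) R ⇔ Shaded (T ∘ cellEmpty π i j) (rows , S)) → 2 ≤ n →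
    occ R π ≡ indicator (positionOf (proj₁ (extremes S n)) π <ᵇ positionOf (proj₂ (extremes S n)) π)
  occ-rows R S R-shape 2≤n =
    trans (occ-single R π (positionOf-range u∈) (positionOf-range w∈) only) (cong indicator at-positions)
    where
    u = proj₁ (extremes S n)
    w = proj₂ (extremes S n)
    ordered  = extremes-ordered S 2≤n
    u∈       = surjective (proj₁ (ordered⇒inRange ordered))
    w∈       = surjective (proj₂ (ordered⇒inRange ordered))
    anchored = isOcc⇔anchored R rows S R-shape
    only : ∀ {i j} → InRange n i → InRange n j → T (isOcc R π i j) →
           (i , j) ≡ (positionOf u π , positionOf w π)
    only i-range j-range t with Equivalence.to (anchored i-range j-range) t
    ... | _ , _ , anchored≡ = cong₂ _,_
      (at-injective unique i-range (positionOf-range u∈) (trans (cong proj₁ anchored≡) (sym (at-positionOf u∈))))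
      (at-injective unique j-range (positionOf-range w∈) (trans (cong proj₂ anchored≡) (sym (at-positionOf w∈))))
    at-positions : isOcc R π (positionOf u π) (positionOf w π) ≡ (positionOf u π <ᵇ positionOf w π)
    at-positions = T-injective
      (λ t → <⇒<ᵇ (proj₁ (Equivalence.to (anchored (positionOf-range u∈) (positionOf-range w∈)) t)))
      (λ t → Equivalence.from (anchored (positionOf-range u∈) (positionOf-range w∈))
        (<ᵇ⇒< _ _ t , subst₂ _<_ (sym (at-positionOf u∈)) (sym (at-positionOf w∈)) (proj₁ (proj₂ ordered)) ,
         cong₂ _,_ (at-positionOf u∈) (at-positionOf w∈)))

-- Involutions of the values

-- The reflection v ↦ n + 1 ∸ v of [0, n + 1], extended by the identity so that it is an
-- involution of all of ℕ.
complement : ℕ → ℕ → ℕ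
complement n v = if v ≤ᵇ suc n then suc n ∸ v else v

complement-≤ : ∀ {n v} → v ≤ suc n → complement n v ≡ suc n ∸ v
complement-≤ v≤ rewrite Equivalence.to T-≡ (≤⇒≤ᵇ v≤) = refl

complement-> : ∀ {n v} → ¬ v ≤ suc n → complement n v ≡ v
complement-> {n} {v} v≰ with v ≤ᵇ suc n in eq
... | true  = contradiction (≤ᵇ⇒≤ v (suc n) (subst T (sym eq) _)) v≰
... | false = refl

complement-involutive : ∀ n v → complement n (complement n v) ≡ v
complement-involutive n v with v ≤? suc n
... | yes v≤ = begin
  complement n (complement n v)  ≡⟨ cong (complement n) (complement-≤ v≤) ⟩
  complement n (suc n ∸ v)       ≡⟨ complement-≤ (m∸n≤m (suc n) v) ⟩
  suc n ∸ (suc n ∸ v)            ≡⟨ m∸[m∸n]≡n v≤ ⟩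
  v                              ∎
  where open ≡-Reasoning
... | no v≰ = trans (cong (complement n) (complement-> v≰)) (complement-> v≰)

complement-range : ∀ {n v} → InRange n v → InRange n (complement n v)
complement-range (0<v , v<N) rewrite complement-≤ (<⇒≤ v<N) = m<n⇒0<n∸m v<N , ∸-monoʳ-< 0<v (<⇒≤ v<N)

complement-flip : ∀ {n x y} → InRange n x → InRange n y → x ≢ y →
                  (complement n x <ᵇ complement n y) ≡ not (x <ᵇ y)
complement-flip {n} {x} {y} (_ , x<N) (_ , y<N) x≢y
  rewrite complement-≤ (<⇒≤ x<N) | complement-≤ (<⇒≤ y<N) with <-cmp x y
... | tri< x<y _ _ = trans (<ᵇ-false (<⇒≤ (∸-monoʳ-< x<y (<⇒≤ y<N)))) (cong not (sym (<ᵇ-true x<y)))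
... | tri≈ _ x≡y _ = contradiction x≡y x≢y
... | tri> _ _ y<x = trans (<ᵇ-true (∸-monoʳ-< y<x (<⇒≤ x<N))) (cong not (sym (<ᵇ-false (<⇒≤ y<x))))

transpose : ℕ → ℕ → ℕ → ℕ
transpose u w v = if v ≡ᵇ u then w else if v ≡ᵇ w then u else v

transpose-involutive : ∀ u w v → transpose u w (transpose u w v) ≡ v
transpose-involutive u w v with v ≡ᵇ u | ≡ᵇ-reflects v u
... | true  | ofʸ refl with w ≡ᵇ v | ≡ᵇ-reflects w v
...   | true  | ofʸ w≡v = w≡v
...   | false | _ rewrite ≡ᵇ-refl w = refl
transpose-involutive u w v | false | ofⁿ v≢u with v ≡ᵇ w | ≡ᵇ-reflects v w
... | true  | ofʸ refl rewrite ≡ᵇ-refl u = refl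
... | false | ofⁿ v≢w rewrite ≡ᵇ-≢ v≢u | ≡ᵇ-≢ v≢w = refl

transpose-range : ∀ {n u w v} → InRange n u → InRange n w → InRange n v → InRange n (transpose u w v)
transpose-range {u = u} {w} {v} u-range w-range v-range with v ≡ᵇ u
... | true = w-range
... | false with v ≡ᵇ w
...   | true  = u-range
...   | false = v-range

transpose-left : ∀ u w → transpose u w u ≡ w
transpose-left u w rewrite ≡ᵇ-refl u = refl

transpose-right : ∀ {u w} → u ≢ w → transpose u w w ≡ u
transpose-right {u} {w} u≢w rewrite ≡ᵇ-≢ (≢-sym u≢w) | ≡ᵇ-refl w = refl

-- The six patterns

shape : Fin 6 → Orientation × StripPair
shape zero                               = rows    , last-two
shape (suc zero)                         = columns , first-two
shape (suc (suc zero))                   = columns , last-two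
shape (suc (suc (suc zero)))             = rows    , first-two
shape (suc (suc (suc (suc zero))))       = columns , outer-two
shape (suc (suc (suc (suc (suc zero))))) = rows    , outer-two

by-cases : ∀ {P : Fin 3 → Set} → P zero → P (suc zero) → P (suc (suc zero)) → ∀ a → P a
by-cases p₀ p₁ p₂ zero             = p₀
by-cases p₀ p₁ p₂ (suc zero)       = p₁
by-cases p₀ p₁ p₂ (suc (suc zero)) = p₂

All-pat⇔Shaded : ∀ (P : Fin 3 × Fin 3 → Set) i → All P (pat i) ⇔ Shaded P (shape i)
All-pat⇔Shaded P zero = mk⇔
  (λ { (p02 ∷ p12 ∷ p22 ∷ p01 ∷ p11 ∷ p21 ∷ []) → by-cases p01 p11 p21 , by-cases p02 p12 p22 })
  (λ (r₁ , r₂) → r₂ _ ∷ r₂ _ ∷ r₂ _ ∷ r₁ _ ∷ r₁ _ ∷ r₁ _ ∷ [])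
All-pat⇔Shaded P (suc zero) = mk⇔
  (λ { (p02 ∷ p12 ∷ p01 ∷ p11 ∷ p00 ∷ p10 ∷ []) → by-cases p00 p01 p02 , by-cases p10 p11 p12 })
  (λ (c₀ , c₁) → c₀ _ ∷ c₁ _ ∷ c₀ _ ∷ c₁ _ ∷ c₀ _ ∷ c₁ _ ∷ [])
All-pat⇔Shaded P (suc (suc zero)) = mk⇔
  (λ { (p12 ∷ p22 ∷ p11 ∷ p21 ∷ p10 ∷ p20 ∷ []) → by-cases p10 p11 p12 , by-cases p20 p21 p22 })
  (λ (c₁ , c₂) → c₁ _ ∷ c₂ _ ∷ c₁ _ ∷ c₂ _ ∷ c₁ _ ∷ c₂ _ ∷ [])
All-pat⇔Shaded P (suc (suc (suc zero))) = mk⇔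
  (λ { (p01 ∷ p11 ∷ p21 ∷ p00 ∷ p10 ∷ p20 ∷ []) → by-cases p00 p10 p20 , by-cases p01 p11 p21 })
  (λ (r₀ , r₁) → r₁ _ ∷ r₁ _ ∷ r₁ _ ∷ r₀ _ ∷ r₀ _ ∷ r₀ _ ∷ [])
All-pat⇔Shaded P (suc (suc (suc (suc zero)))) = mk⇔
  (λ { (p02 ∷ p22 ∷ p01 ∷ p21 ∷ p00 ∷ p20 ∷ []) → by-cases p00 p01 p02 , by-cases p20 p21 p22 })
  (λ (c₀ , c₂) → c₀ _ ∷ c₂ _ ∷ c₀ _ ∷ c₂ _ ∷ c₀ _ ∷ c₂ _ ∷ [])
All-pat⇔Shaded P (suc (suc (suc (suc (suc zero))))) = mk⇔
  (λ { (p02 ∷ p12 ∷ p22 ∷ p00 ∷ p10 ∷ p20 ∷ []) → by-cases p00 p10 p20 , by-cases p02 p12 p22 })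
  (λ (r₀ , r₂) → r₂ _ ∷ r₂ _ ∷ r₂ _ ∷ r₀ _ ∷ r₀ _ ∷ r₀ _ ∷ [])

column-distribution : ∀ R S → (∀ P → All P R ⇔ Shaded P (columns , S)) →
                      ∀ {n} → 2 ≤ n → ∀ k → s n k R ≡ halfDistribution n k
column-distribution R S R-shape {n} 2≤n =
  s≡halfDistribution (complement-involutive n) complement-range R occurs occ≡ toggles
  where
  p = proj₁ (extremes S n)
  q = proj₂ (extremes S n)
  occurs : List ℕ → Bool
  occurs π = at π p <ᵇ at π q
  occ≡ : ∀ {π} → π ∈ Sym n → occ R π ≡ indicator (occurs π)
  occ≡ π∈ with ∈-Sym⁻ {n} π∈
  ... | refl , perm = Occurrences.occ-columns perm R S (R-shape _) 2≤n
  toggles : ∀ {π} → π ∈ Sym n → occurs (map (complement n) π) ≡ not (occurs π)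
  toggles {π} π∈ with ∈-Sym⁻ {n} π∈
  ... | refl , perm = begin
    at (map (complement n) π) p <ᵇ at (map (complement n) π) q
      ≡⟨ cong₂ _<ᵇ_ (at-map (complement n) π p-range) (at-map (complement n) π q-range) ⟩
    complement n (at π p) <ᵇ complement n (at π q)
      ≡⟨ complement-flip (range (at-∈ π p-range)) (range (at-∈ π q-range))
                         (<⇒≢ p<q ∘ at-injective unique p-range q-range) ⟩
    not (at π p <ᵇ at π q) ∎
    where
    open ≡-Reasoning
    open IsPermutation perm
    ordered = extremes-ordered S 2≤n
    p<q     = proj₁ (proj₂ ordered)
    p-range = proj₁ (ordered⇒inRange ordered)
    q-range = proj₂ (ordered⇒inRange ordered)

row-distribution : ∀ R S → (∀ P → All P R ⇔ Shaded P (rows , S)) →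
                   ∀ {n} → 2 ≤ n → ∀ k → s n k R ≡ halfDistribution n k
row-distribution R S R-shape {n} 2≤n =
  s≡halfDistribution (transpose-involutive u w) (transpose-range u-range w-range) R occurs occ≡ toggles
  where
  u = proj₁ (extremes S n)
  w = proj₂ (extremes S n)
  ordered = extremes-ordered S 2≤n
  u<w     = proj₁ (proj₂ ordered)
  u-range = proj₁ (ordered⇒inRange ordered)
  w-range = proj₂ (ordered⇒inRange ordered)
  occurs : List ℕ → Bool
  occurs π = positionOf u π <ᵇ positionOf w π
  occ≡ : ∀ {π} → π ∈ Sym n → occ R π ≡ indicator (occurs π)
  occ≡ π∈ with ∈-Sym⁻ {n} π∈
  ... | refl , perm = Occurrences.occ-rows perm R S (R-shape _) 2≤n
  toggles : ∀ {π} → π ∈ Sym n → occurs (map (transpose u w) π) ≡ not (occurs π)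
  toggles {π} π∈ with ∈-Sym⁻ {n} π∈
  ... | refl , perm = begin
    positionOf u (map (transpose u w) π) <ᵇ positionOf w (map (transpose u w) π)
      ≡⟨ cong₂ _<ᵇ_ (positionOf-transposed u) (positionOf-transposed w) ⟩
    positionOf (transpose u w u) π <ᵇ positionOf (transpose u w w) π
      ≡⟨ cong₂ (λ x y → positionOf x π <ᵇ positionOf y π)
               (transpose-left u w) (transpose-right (<⇒≢ u<w)) ⟩
    positionOf w π <ᵇ positionOf u π
      ≡⟨ <ᵇ-flip positions-differ ⟩
    not (positionOf u π <ᵇ positionOf w π) ∎
    where
    open ≡-Reasoning
    open IsPermutation perm
    positionOf-transposed : ∀ v → positionOf v (map (transpose u w) π) ≡ positionOf (transpose u w v) π
    positionOf-transposed v =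
      trans (cong (λ x → positionOf x (map (transpose u w) π)) (sym (transpose-involutive u w v)))
            (positionOf-map (involutive⇒injective (transpose-involutive u w)) _ π)
    positions-differ : positionOf u π ≢ positionOf w π
    positions-differ eq = <⇒≢ u<w (begin
      u                      ≡⟨ at-positionOf (surjective u-range) ⟨
      at π (positionOf u π)  ≡⟨ cong (at π) eq ⟩
      at π (positionOf w π)  ≡⟨ at-positionOf (surjective w-range) ⟩
      w                      ∎)

s-pat≡halfDistribution : ∀ i {n} → 2 ≤ n → ∀ k → s n k (pat i) ≡ halfDistribution n k
s-pat≡halfDistribution i = by-shape (shape i) (λ P → All-pat⇔Shaded P i)
  where
  by-shape : ∀ sh → (∀ P → All P (pat i) ⇔ Shaded P sh) →
             ∀ {n} → 2 ≤ n → ∀ k → s n k (pat i) ≡ halfDistribution n k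
  by-shape (columns , S) = column-distribution (pat i) S
  by-shape (rows    , S) = row-distribution (pat i) S

s-pattern-irrelevant : ∀ R R' {n} → n < 2 → ∀ k → s n k R ≡ s n k R'
s-pattern-irrelevant R R' {0}          _ 0       = refl
s-pattern-irrelevant R R' {0}          _ (suc k) = refl
s-pattern-irrelevant R R' {1}          _ 0       = refl
s-pattern-irrelevant R R' {1}          _ (suc k) = refl
s-pattern-irrelevant R R' {suc (suc n)} (s≤s (s≤s ()))

theorem3p7 : ((i j : Fin 6) → Equidistributed (pat i) (pat j))
    × ((i : Fin 6) →
        (s 0 0 (pat i) ≡ 1) × (s 1 0 (pat i) ≡ 1)
        × ((n : ℕ) → 2 ≤ n → (s n 0 (pat i) ≡ (n !) / 2) × (s n 1 (pat i) ≡ (n !) / 2)))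
theorem3p7 = equidistributed , λ i → refl , refl , λ n 2≤n →
  s-pat≡halfDistribution i 2≤n 0 , s-pat≡halfDistribution i 2≤n 1
  where
  equidistributed : ∀ i j → Equidistributed (pat i) (pat j)
  equidistributed i j 0               = s-pattern-irrelevant (pat i) (pat j) (s≤s z≤n)
  equidistributed i j 1               = s-pattern-irrelevant (pat i) (pat j) (s≤s (s≤s z≤n))
  equidistributed i j n@(suc (suc _)) k = trans (s-pat≡halfDistribution i {n} 2≤n k)
                                                (sym (s-pat≡halfDistribution j 2≤n k))
    where 2≤n = s≤s (s≤s z≤n)
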